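{- Let $\xi$ be a finite collection of connected graphs each containing a cycle, let $k\ge1$, and suppose that $\frac{b_t}{(1-T(z))^{3t}}-\widehat W_{t,\xi}(z)\succeq0$ for every $t$ with $1\le t\le k-1$. Then $$\Lambda^{(\xi)}_k\preceq9\,\mathcal B_k\,\frac{T(z)^2}{(1-T(z))^{3k+4}}.$$
   Context: $T(z)=\sum_{n\ge1}n^{n-1}z^n/n!$; $\vartheta_z=z\frac{d}{dz}$. $\widehat W_{t,\xi}(z)=\sum_n g_{n,t}z^n/n!$ with $g_{n,t}$ the number of connected simple graphs on $\{1,\dots,n\}$ with $n+t$ edges containing no (not necessarily induced) subgraph isomorphic to a member of $\xi$. $A\preceq B$ means $[z^n]A\le[z^n]B$ for all $n$. $\Lambda^{(\xi)}_k=\sum_{t=1}^{k-1}(\vartheta_z\widehat W_{t,\xi})(\vartheta_z\widehat W_{k-t,\xi})$ (empty sum $=0$). Wright's constants $b_1=\frac5{24}$, $2(k+1)b_{k+1}=3k(k+1)b_k+3\sum_{t=1}^{k-1}t(k-t)b_tb_{k-t}$; $\mathcal B_k=\sum_{t=1}^{k-1}t(k-t)b_tb_{k-t}$. -}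

module Defs where

open import Data.Nat as ℕ using (ℕ; zero; suc; _∸_; _^_; _!)
open import Data.Nat.Properties using (_!≢0)
open import Data.Integer using (+_)
open import Data.Rational as ℚ using (ℚ; 0ℚ; 1ℚ; _/_)
open import Data.Fin using (Fin; zero; suc; toℕ; fromℕ; inject₁)
open import Data.Fin.Properties using ()
open import Data.Vec using (Vec; []; _∷_; lookup)
open import Data.Bool using (Bool; true; false; T)
open import Data.Unit using (⊤; tt)
open import Data.Product using (Σ; _×_; _,_; ∃)
open import Data.List using (List)
open import Data.List.Relation.Unary.All using (All)
open import Data.List.Relation.Unary.Any using (Any)
open import Relation.Nullary using (¬_)
open import Relation.Binary.PropositionalEquality using (_≡_)
open import Function.Definitions using (Injective)
open import Function.Bundles using (_↔_)

-- Finite simple graphs on the vertex set Fin n (= {1,…,n}).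
-- A graph on suc n vertices is a graph on the first n vertices together
-- with the adjacency row (a Vec Bool n) of the last vertex to the others.

Graph : ℕ → Set
Graph zero    = ⊤
Graph (suc n) = Graph n × Vec Bool n

-- adjacency as a Boolean (symmetric, irreflexive by construction)
adj : ∀ {n} → Graph n → Fin n → Fin n → Bool
adj {suc n} (G , r) zero    zero    = false
adj {suc n} (G , r) zero    (suc j) = lookup r j
adj {suc n} (G , r) (suc i) zero    = lookup r i
adj {suc n} (G , r) (suc i) (suc j) = adj G i j

-- NOTE on indexing: in this encoding vertex 'zero' of Fin (suc n) is the
-- newly added vertex and 'suc i' are the old vertices; any fixed labelling
-- convention is fine since only counts/isomorphism types matter.

Adj : ∀ {n} → Graph n → Fin n → Fin n → Set
Adj G i j = T (adj G i j)

edges : ∀ {n} → Graph n → ℕ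
edges {zero}  tt      = 0
edges {suc n} (G , r) = edges G ℕ.+ count r
  where
  count : ∀ {m} → Vec Bool m → ℕ
  count []          = 0
  count (true ∷ v)  = suc (count v)
  count (false ∷ v) = count v

data Walk {n} (G : Graph n) : Fin n → Fin n → Set where
  here : ∀ {u} → Walk G u u
  step : ∀ {u v w} → Adj G u v → Walk G v w → Walk G u w

Connected : ∀ {n} → Graph n → Set
Connected {n} G = (u v : Fin n) → Walk G u v

HasCycle : ∀ {n} → Graph n → Set
HasCycle {n} G =
  Σ ℕ λ m → (2 ℕ.≤ m) × Σ (Fin (suc m) → Fin n) λ f →
    Injective _≡_ _≡_ f ×
    ((i : Fin m) → Adj G (f (inject₁ i)) (f (suc i))) ×
    Adj G (f (fromℕ m)) (f zero)

-- H is (isomorphic to) a not necessarily induced subgraph of G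
SubgraphOf : ∀ {h n} → Graph h → Graph n → Set
SubgraphOf {h} {n} H G =
  Σ (Fin h → Fin n) λ f →
    Injective _≡_ _≡_ f × ((i j : Fin h) → Adj H i j → Adj G (f i) (f j))

AnyGraph : Set
AnyGraph = Σ ℕ Graph

Free : List AnyGraph → ∀ {n} → Graph n → Set
Free ξ G = All (λ H → ¬ SubgraphOf (Data.Product.proj₂ H) G) ξ

-- connected graphs on {1..n} with n+t edges containing no member of ξ;
-- proof components are irrelevant so that elements are just graphs
record Good (ξ : List AnyGraph) (n t : ℕ) : Set where
  constructor good
  field
    graph      : Graph n
    .connected : Connected graph
    .edgeCount : edges graph ≡ n ℕ.+ t
    .free      : Free ξ graph

IsCountOf : List AnyGraph → (ℕ → ℕ → ℕ) → Set
IsCountOf ξ g = ∀ n t → Fin (g n t) ↔ Good ξ n t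

-- Formal power series over ℚ (exponential variable z), as coefficient maps

Series : Set
Series = ℕ → ℚ

sumUpTo : (ℕ → ℚ) → ℕ → ℚ
sumUpTo f zero    = f 0
sumUpTo f (suc n) = sumUpTo f n ℚ.+ f (suc n)

-- Σ_{i=a}^{b} f i  (0 if b < a), by iteration over b
sumFromTo : ℕ → ℕ → (ℕ → ℚ) → ℚ
sumFromTo a zero    f with a
... | zero  = f 0
... | suc _ = 0ℚ
sumFromTo a (suc b) f with a ℕ.≤ᵇ suc b
... | true  = sumFromTo a b f ℚ.+ f (suc b)
... | false = 0ℚ

infixl 7 _⊛_
_⊛_ : Series → Series → Series
(A ⊛ B) n = sumUpTo (λ i → A i ℚ.* B (n ∸ i)) n

oneS : Series
oneS zero    = 1ℚ
oneS (suc n) = 0ℚ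

powS : Series → ℕ → Series
powS A zero    = oneS
powS A (suc m) = A ⊛ powS A m

scale : ℚ → Series → Series
scale c A n = c ℚ.* A n

-- ϑ_z = z d/dz
theta : Series → Series
theta A n = (+ n / 1) ℚ.* A n

over! : ℕ → ℕ → ℚ
over! a n = (+ a / (n !)) {{n !≢0}}

Tz : Series
Tz zero    = 0ℚ
Tz (suc n) = over! (suc n ^ n) (suc n)

-- 1/(1 - T(z)) = Σ_{j≥0} T(z)^j (well-defined since T(0)=0; only j ≤ n
-- contribute to [z^n])
invOneMinusT : Series
invOneMinusT n = sumUpTo (λ j → powS Tz j n) n

invOneMinusTPow : ℕ → Series
invOneMinusTPow m = powS invOneMinusT m

What : (ℕ → ℕ → ℕ) → ℕ → Series
What g t n = over! (g n t) n

Lambda : (ℕ → ℕ → ℕ) → ℕ → Series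
Lambda g k n = sumFromTo 1 (k ∸ 1) (λ t → (theta (What g t) ⊛ theta (What g (k ∸ t))) n)

_⪯_ : Series → Series → Set
A ⪯ B = ∀ n → A n ℚ.≤ B n

zeroS : Series
zeroS _ = 0ℚ

_-S_ : Series → Series → Series
(A -S B) n = A n ℚ.- B n

ℚn : ℕ → ℚ
ℚn n = + n / 1

calB : (ℕ → ℚ) → ℕ → ℚ
calB b k = sumFromTo 1 (k ∸ 1) (λ t → ℚn t ℚ.* ℚn (k ∸ t) ℚ.* b t ℚ.* b (k ∸ t))

IsWright : (ℕ → ℚ) → Set
IsWright b =
  (b 1 ≡ + 5 / 24) ×
  (∀ k → 1 ℕ.≤ k →
    ℚn (2 ℕ.* (k ℕ.+ 1)) ℚ.* b (k ℕ.+ 1)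
      ≡ ℚn (3 ℕ.* k ℕ.* (k ℕ.+ 1)) ℚ.* b k ℚ.+ ℚn 3 ℚ.* calB b k)

{-# OPTIONS --safe #-}

-- Write I = 1/(1-T). Coefficientwise, ϑT = T + T·ϑT says
-- n^n = Σ_{i=1}^n C(n,i) i^(i-1) (n-i)^(n-i), a consequence of Abel's identity
-- Σ_k C(n,k) x(x+k)^(k-1) (y+n-k)^(n-k) = (x+y+n)^n, which follows by induction on n from
-- Pascal's rule. Since T has no constant term, X = A + T·X has at most one solution, and
-- comparing such fixed-point equations gives ϑT = T·I, ϑI = T·I³ and ϑ(I^m) = m·T·I^(m+2).
-- As ϑ multiplies the n-th coefficient by n ≥ 0, the hypothesis Ŵ_t ⪯ b_t I^(3t) gives
-- ϑŴ_t ⪯ 3t b_t T I^(3t+2). All series involved are nonnegative, so these bounds multiply: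
-- ϑŴ_t ϑŴ_(k-t) ⪯ 9 t(k-t) b_t b_(k-t) T² I^(3k+4), and summing over t gives the claim.

module Submission where

open import Defs
open import Data.Nat using (ℕ; _≤_; _∸_; _*_; _+_)
open import Data.Rational as ℚ using (ℚ)
open import Data.List using (List)
open import Data.List.Relation.Unary.All using (All)
open import Data.Product using (_×_; proj₂)

open import Algebra.Bundles using (CommutativeSemiring; CommutativeRing)
import Algebra.Properties.CommutativeSemigroup as CommutativeSemigroupProperties
open import Data.Nat using (zero; suc; _<_; z≤n; s≤s; _^_; _!; NonZero)
import Data.Nat.Properties as ℕP
open import Data.Nat.Tactic.RingSolver using (solve-∀)
open import Data.Rational using (0ℚ; 1ℚ)
import Data.Rational.Properties as ℚP
open import Data.Rational.Solver using (module +-*-Solver)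
open import Function using (_∘_)
open import Relation.Binary.PropositionalEquality
  using (_≡_; refl; sym; trans; cong; cong₂; _≗_; module ≡-Reasoning)
open import Relation.Nullary using (yes; no)

module ℚ* = CommutativeSemigroupProperties (CommutativeRing.*-commutativeSemigroup ℚP.+-*-commutativeRing)

module RangeSum {c ℓ} (R : CommutativeSemiring c ℓ) where

  open CommutativeSemiring R
    using (Carrier; _≈_; 0#; setoid; +-cong; +-congˡ; +-congʳ; *-congˡ; +-assoc; +-comm;
           +-identityˡ; +-identityʳ; *-comm; distribˡ; +-commutativeSemigroup)
    renaming (_+_ to infixl 6 _⊕_; _*_ to infixl 7 _⊗_; refl to ≈-refl; sym to ≈-sym; trans to ≈-trans)
  open CommutativeSemigroupProperties +-commutativeSemigroup using (interchange)
  open import Relation.Binary.Reasoning.Setoid setoid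

  -- The sum is characterised by its recursion equations rather than defined here, so that
  -- the lemmas apply verbatim to Defs.sumUpTo over ℚ as well as to sums over ℕ.
  module Properties (∑ : (ℕ → Carrier) → ℕ → Carrier)
                    (∑-0 : ∀ f → ∑ f 0 ≈ f 0)
                    (∑-suc : ∀ f n → ∑ f (suc n) ≈ ∑ f n ⊕ f (suc n)) where

    ∑-cong : ∀ {f g} n → (∀ i → i ≤ n → f i ≈ g i) → ∑ f n ≈ ∑ g n
    ∑-cong {f} {g} zero f≈g = begin
      ∑ f 0 ≈⟨ ∑-0 f ⟩
      f 0   ≈⟨ f≈g 0 z≤n ⟩
      g 0   ≈⟨ ∑-0 g ⟨
      ∑ g 0 ∎
    ∑-cong {f} {g} (suc n) f≈g = begin
      ∑ f (suc n)       ≈⟨ ∑-suc f n ⟩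
      ∑ f n ⊕ f (suc n) ≈⟨ +-cong (∑-cong n (λ i i≤n → f≈g i (ℕP.m≤n⇒m≤1+n i≤n))) (f≈g (suc n) ℕP.≤-refl) ⟩
      ∑ g n ⊕ g (suc n) ≈⟨ ∑-suc g n ⟨
      ∑ g (suc n)       ∎

    ∑-zeros : ∀ f n → (∀ i → i ≤ n → f i ≈ 0#) → ∑ f n ≈ 0#
    ∑-zeros f zero f≈0 = ≈-trans (∑-0 f) (f≈0 0 z≤n)
    ∑-zeros f (suc n) f≈0 = begin
      ∑ f (suc n)       ≈⟨ ∑-suc f n ⟩
      ∑ f n ⊕ f (suc n) ≈⟨ +-cong (∑-zeros f n (λ i i≤n → f≈0 i (ℕP.m≤n⇒m≤1+n i≤n))) (f≈0 (suc n) ℕP.≤-refl) ⟩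
      0# ⊕ 0#           ≈⟨ +-identityˡ 0# ⟩
      0#                ∎

    ∑-distrib-+ : ∀ f g n → ∑ (λ i → f i ⊕ g i) n ≈ ∑ f n ⊕ ∑ g n
    ∑-distrib-+ f g zero = ≈-trans (∑-0 _) (≈-sym (+-cong (∑-0 f) (∑-0 g)))
    ∑-distrib-+ f g (suc n) = begin
      ∑ (λ i → f i ⊕ g i) (suc n)                     ≈⟨ ∑-suc _ n ⟩
      ∑ (λ i → f i ⊕ g i) n ⊕ (f (suc n) ⊕ g (suc n)) ≈⟨ +-congʳ (∑-distrib-+ f g n) ⟩
      (∑ f n ⊕ ∑ g n) ⊕ (f (suc n) ⊕ g (suc n))       ≈⟨ interchange _ _ _ _ ⟩
      (∑ f n ⊕ f (suc n)) ⊕ (∑ g n ⊕ g (suc n))       ≈⟨ +-cong (∑-suc f n) (∑-suc g n) ⟨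
      ∑ f (suc n) ⊕ ∑ g (suc n)                       ∎

    ∑-distribˡ : ∀ a f n → a ⊗ ∑ f n ≈ ∑ (λ i → a ⊗ f i) n
    ∑-distribˡ a f zero = ≈-trans (*-congˡ (∑-0 f)) (≈-sym (∑-0 _))
    ∑-distribˡ a f (suc n) = begin
      a ⊗ ∑ f (suc n)                     ≈⟨ *-congˡ (∑-suc f n) ⟩
      a ⊗ (∑ f n ⊕ f (suc n))             ≈⟨ distribˡ a _ _ ⟩
      a ⊗ ∑ f n ⊕ a ⊗ f (suc n)           ≈⟨ +-congʳ (∑-distribˡ a f n) ⟩
      ∑ (λ i → a ⊗ f i) n ⊕ a ⊗ f (suc n) ≈⟨ ∑-suc _ n ⟨
      ∑ (λ i → a ⊗ f i) (suc n)           ∎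

    ∑-distribʳ : ∀ a f n → ∑ f n ⊗ a ≈ ∑ (λ i → f i ⊗ a) n
    ∑-distribʳ a f n = begin
      ∑ f n ⊗ a           ≈⟨ *-comm _ a ⟩
      a ⊗ ∑ f n           ≈⟨ ∑-distribˡ a f n ⟩
      ∑ (λ i → a ⊗ f i) n ≈⟨ ∑-cong n (λ i _ → *-comm a (f i)) ⟩
      ∑ (λ i → f i ⊗ a) n ∎

    ∑-head : ∀ f n → ∑ f (suc n) ≈ f 0 ⊕ ∑ (f ∘ suc) n
    ∑-head f zero = ≈-trans (∑-suc f 0) (+-cong (∑-0 f) (≈-sym (∑-0 _)))
    ∑-head f (suc n) = begin
      ∑ f (suc (suc n))                       ≈⟨ ∑-suc f (suc n) ⟩
      ∑ f (suc n) ⊕ f (suc (suc n))           ≈⟨ +-congʳ (∑-head f n) ⟩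
      (f 0 ⊕ ∑ (f ∘ suc) n) ⊕ f (suc (suc n)) ≈⟨ +-assoc _ _ _ ⟩
      f 0 ⊕ (∑ (f ∘ suc) n ⊕ f (suc (suc n))) ≈⟨ +-congˡ (∑-suc _ n) ⟨
      f 0 ⊕ ∑ (f ∘ suc) (suc n)               ∎

    ∑-reverse : ∀ f n → ∑ f n ≈ ∑ (λ i → f (n ∸ i)) n
    ∑-reverse f zero = ≈-trans (∑-0 f) (≈-sym (∑-0 _))
    ∑-reverse f (suc n) = begin
      ∑ f (suc n)                       ≈⟨ ∑-suc f n ⟩
      ∑ f n ⊕ f (suc n)                 ≈⟨ +-congʳ (∑-reverse f n) ⟩
      ∑ (λ i → f (n ∸ i)) n ⊕ f (suc n) ≈⟨ +-comm _ _ ⟩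
      f (suc n) ⊕ ∑ (λ i → f (n ∸ i)) n ≈⟨ ∑-head (λ i → f (suc n ∸ i)) n ⟨
      ∑ (λ i → f (suc n ∸ i)) (suc n)   ∎

    ∑-comm : ∀ (f : ℕ → ℕ → Carrier) n m →
             ∑ (λ i → ∑ (f i) m) n ≈ ∑ (λ j → ∑ (λ i → f i j) n) m
    ∑-comm f zero m = ≈-trans (∑-0 _) (∑-cong m (λ j _ → ≈-sym (∑-0 _)))
    ∑-comm f (suc n) m = begin
      ∑ (λ i → ∑ (f i) m) (suc n)                     ≈⟨ ∑-suc _ n ⟩
      ∑ (λ i → ∑ (f i) m) n ⊕ ∑ (f (suc n)) m         ≈⟨ +-congʳ (∑-comm f n m) ⟩
      ∑ (λ j → ∑ (λ i → f i j) n) m ⊕ ∑ (f (suc n)) m ≈⟨ ∑-distrib-+ _ _ m ⟨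
      ∑ (λ j → ∑ (λ i → f i j) n ⊕ f (suc n) j) m     ≈⟨ ∑-cong m (λ j _ → ≈-sym (∑-suc _ n)) ⟩
      ∑ (λ j → ∑ (λ i → f i j) (suc n)) m             ∎

    ∑-triangle : ∀ (f : ℕ → ℕ → Carrier) n →
                 ∑ (λ i → ∑ (f i) i) n ≈ ∑ (λ j → ∑ (λ l → f (j + l) j) (n ∸ j)) n
    ∑-triangle f zero = begin
      ∑ (λ i → ∑ (f i) i) 0 ≈⟨ ∑-0 _ ⟩
      ∑ (f 0) 0             ≈⟨ ∑-0 _ ⟩
      f 0 0                 ≈⟨ ∑-0 _ ⟨
      ∑ (λ l → f l 0) 0     ≈⟨ ∑-0 _ ⟨
      ∑ (λ j → ∑ (λ l → f (j + l) j) (0 ∸ j)) 0 ∎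
    ∑-triangle f (suc n) = begin
      ∑ (λ i → ∑ (f i) i) (suc n)                                   ≈⟨ ∑-suc _ n ⟩
      ∑ (λ i → ∑ (f i) i) n ⊕ ∑ (f (suc n)) (suc n)                 ≈⟨ +-cong (∑-triangle f n) (∑-suc _ n) ⟩
      ∑ (column n) n ⊕ (∑ (f (suc n)) n ⊕ f (suc n) (suc n))        ≈⟨ +-assoc _ _ _ ⟨
      (∑ (column n) n ⊕ ∑ (f (suc n)) n) ⊕ f (suc n) (suc n)        ≈⟨ +-cong (∑-distrib-+ _ _ n) corner ⟨
      ∑ (λ j → column n j ⊕ f (suc n) j) n ⊕ column (suc n) (suc n) ≈⟨ +-congʳ (∑-cong n extend-column) ⟩
      ∑ (column (suc n)) n ⊕ column (suc n) (suc n)                 ≈⟨ ∑-suc _ n ⟨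
      ∑ (column (suc n)) (suc n)                                    ∎
      where
      column : ℕ → ℕ → Carrier
      column m j = ∑ (λ l → f (j + l) j) (m ∸ j)

      corner : column (suc n) (suc n) ≈ f (suc n) (suc n)
      corner = begin
        ∑ (λ l → f (suc n + l) (suc n)) (suc n ∸ suc n) ≡⟨ cong (∑ _) (ℕP.n∸n≡0 n) ⟩
        ∑ (λ l → f (suc n + l) (suc n)) 0               ≈⟨ ∑-0 _ ⟩
        f (suc n + 0) (suc n)                           ≡⟨ cong (λ m → f m (suc n)) (ℕP.+-identityʳ (suc n)) ⟩
        f (suc n) (suc n)                               ∎

      extend-column : ∀ j → j ≤ n → column n j ⊕ f (suc n) j ≈ column (suc n) j
      extend-column j j≤n = begin
        column n j ⊕ f (suc n) j            ≡⟨ cong (λ m → column n j ⊕ f m j) 1+n≡j+[1+n∸j] ⟩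
        column n j ⊕ f (j + suc (n ∸ j)) j  ≈⟨ ∑-suc _ (n ∸ j) ⟨
        ∑ (λ l → f (j + l) j) (suc (n ∸ j)) ≡⟨ cong (∑ _) (ℕP.+-∸-assoc 1 j≤n) ⟨
        column (suc n) j                    ∎
        where
        1+n≡j+[1+n∸j] : suc n ≡ j + suc (n ∸ j)
        1+n≡j+[1+n∸j] = sym (trans (ℕP.+-suc j (n ∸ j)) (cong suc (ℕP.m+[n∸m]≡n j≤n)))

    ∑-extend : ∀ f n N → n ≤ N → (∀ i → n < i → f i ≈ 0#) → ∑ f N ≈ ∑ f n
    ∑-extend f n zero z≤n _ = ≈-refl
    ∑-extend f n (suc N) n≤1+N f≈0 with n ℕP.≟ suc N
    ... | yes refl = ≈-refl
    ... | no n≢1+N = begin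
      ∑ f (suc N)       ≈⟨ ∑-suc f N ⟩
      ∑ f N ⊕ f (suc N) ≈⟨ +-cong (∑-extend f n N n≤N f≈0) (f≈0 (suc N) (s≤s n≤N)) ⟩
      ∑ f n ⊕ 0#        ≈⟨ +-identityʳ _ ⟩
      ∑ f n             ∎
      where
      n≤N : n ≤ N
      n≤N = ℕP.≤-pred (ℕP.≤∧≢⇒< n≤1+N n≢1+N)

module BinomialConvolution where

  open import Data.Nat.Properties
  open import Data.Nat.Combinatorics
    using (_C_; nCn≡1; k>n⇒nCk≡0; nCk≡nC[n∸k]; nCk≡n!/k![n-k]!; k![n∸k]!∣n!; nCk+nC[k+1]≡[n+1]C[k+1])
  open import Data.Nat.DivMod using (_/_; m/n*n≡m)
  open ≡-Reasoning

  module ℕ+ = CommutativeSemigroupProperties +-commutativeSemigroup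
  module ℕ* = CommutativeSemigroupProperties *-commutativeSemigroup

  ∑ℕ : (ℕ → ℕ) → ℕ → ℕ
  ∑ℕ f zero    = f 0
  ∑ℕ f (suc n) = ∑ℕ f n + f (suc n)

  module ∑ℕ = RangeSum.Properties +-*-commutativeSemiring ∑ℕ (λ _ → refl) (λ _ _ → refl)

  C-factorial : ∀ {n k} → k ≤ n → (n C k) * (k ! * (n ∸ k) !) ≡ n !
  C-factorial {n} {k} k≤n = begin
    (n C k) * (k ! * (n ∸ k) !)                 ≡⟨ cong (_* (k ! * (n ∸ k) !)) (nCk≡n!/k![n-k]! k≤n) ⟩
    n ! / (k ! * (n ∸ k) !) * (k ! * (n ∸ k) !) ≡⟨ m/n*n≡m (k![n∸k]!∣n! k≤n) ⟩
    n !                                         ∎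
    where instance _ = k !* (n ∸ k) !≢0

  C-absorb : ∀ {n k} → k ≤ n → (suc n C k) * (suc n ∸ k) ≡ suc n * (n C k)
  C-absorb {n} {k} k≤n = *-cancelʳ-≡ _ _ (k ! * (n ∸ k) !) (begin
    (suc n C k) * (suc n ∸ k) * (k ! * (n ∸ k) !) ≡⟨ cong (λ m → (suc n C k) * m * (k ! * (n ∸ k) !)) 1+n∸k≡1+[n∸k] ⟩
    (suc n C k) * suc (n ∸ k) * (k ! * (n ∸ k) !) ≡⟨ regroup (suc n C k) (n ∸ k) (k !) ((n ∸ k) !) ⟩
    (suc n C k) * (k ! * suc (n ∸ k) !)           ≡⟨ cong (λ m → (suc n C k) * (k ! * m !)) 1+n∸k≡1+[n∸k] ⟨
    (suc n C k) * (k ! * (suc n ∸ k) !)           ≡⟨ C-factorial (m≤n⇒m≤1+n k≤n) ⟩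
    suc n !                                       ≡⟨ cong (suc n *_) (C-factorial k≤n) ⟨
    suc n * ((n C k) * (k ! * (n ∸ k) !))         ≡⟨ *-assoc (suc n) (n C k) (k ! * (n ∸ k) !) ⟨
    suc n * (n C k) * (k ! * (n ∸ k) !)                ∎)
    where
    instance _ = k !* (n ∸ k) !≢0
    1+n∸k≡1+[n∸k] : suc n ∸ k ≡ suc (n ∸ k)
    1+n∸k≡1+[n∸k] = +-∸-assoc 1 k≤n
    regroup : ∀ c m a b → c * suc m * (a * b) ≡ c * (a * (b + m * b))
    regroup = solve-∀

  infixl 7 _⋆_

  _⋆_ : (ℕ → ℕ) → (ℕ → ℕ) → ℕ → ℕ
  (c ⋆ d) n = ∑ℕ (λ k → (n C k) * c k * d (n ∸ k)) n

  shift : (ℕ → ℕ) → ℕ → ℕ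
  shift c = c ∘ suc

  ⋆-comm : ∀ c d → c ⋆ d ≗ d ⋆ c
  ⋆-comm c d n = trans (∑ℕ.∑-reverse _ n) (∑ℕ.∑-cong n reversed-term)
    where
    reversed-term : ∀ k → k ≤ n → (n C (n ∸ k)) * c (n ∸ k) * d (n ∸ (n ∸ k)) ≡ (n C k) * d k * c (n ∸ k)
    reversed-term k k≤n = begin
      (n C (n ∸ k)) * c (n ∸ k) * d (n ∸ (n ∸ k))
        ≡⟨ cong₂ (λ a b → a * c (n ∸ k) * d b) (sym (nCk≡nC[n∸k] k≤n)) (m∸[m∸n]≡n k≤n) ⟩
      (n C k) * c (n ∸ k) * d k
        ≡⟨ ℕ*.xy∙z≈xz∙y (n C k) _ _ ⟩
      (n C k) * d k * c (n ∸ k)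
        ∎

  ⋆-congʳ : ∀ c {d e} → d ≗ e → c ⋆ d ≗ c ⋆ e
  ⋆-congʳ c d≗e n = ∑ℕ.∑-cong n (λ k _ → cong ((n C k) * c k *_) (d≗e (n ∸ k)))

  ⋆-distribˡ-+ : ∀ c d e n → (c ⋆ (λ m → d m + e m)) n ≡ (c ⋆ d) n + (c ⋆ e) n
  ⋆-distribˡ-+ c d e n = trans (∑ℕ.∑-cong n (λ k _ → *-distribˡ-+ ((n C k) * c k) _ _)) (∑ℕ.∑-distrib-+ _ _ n)

  ⋆-scaleʳ : ∀ a c d n → (c ⋆ (λ m → a * d m)) n ≡ a * (c ⋆ d) n
  ⋆-scaleʳ a c d n = trans (∑ℕ.∑-cong n (λ k _ → ℕ*.x∙yz≈y∙xz ((n C k) * c k) a _)) (sym (∑ℕ.∑-distribˡ a _ n))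

  ⋆-leibniz : ∀ c d n → (c ⋆ d) (suc n) ≡ (shift c ⋆ d) n + (c ⋆ shift d) n
  ⋆-leibniz c d n = begin
    (c ⋆ d) (suc n) ≡⟨ ∑ℕ.∑-head _ n ⟩
    first + ∑ℕ (λ j → (suc n C suc j) * c (suc j) * d (n ∸ j)) n
      ≡⟨ cong (first +_) (trans (∑ℕ.∑-cong n pascal) (∑ℕ.∑-distrib-+ lower upper n)) ⟩
    first + ((shift c ⋆ d) n + ∑ℕ upper n) ≡⟨ ℕ+.x∙yz≈y∙xz first ((shift c ⋆ d) n) (∑ℕ upper n) ⟩
    (shift c ⋆ d) n + (first + ∑ℕ upper n) ≡⟨ cong ((shift c ⋆ d) n +_) (∑ℕ.∑-head shifted n) ⟨
    (shift c ⋆ d) n + ∑ℕ shifted (suc n)   ≡⟨ cong ((shift c ⋆ d) n +_) drop-last ⟩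
    (shift c ⋆ d) n + (c ⋆ shift d) n      ∎
    where
    first : ℕ
    first = 1 * c 0 * d (suc n)

    lower upper shifted : ℕ → ℕ
    lower j = (n C j) * c (suc j) * d (n ∸ j)
    upper j = (n C suc j) * c (suc j) * d (n ∸ j)
    shifted k = (n C k) * c k * d (suc n ∸ k)

    pascal : ∀ j → j ≤ n → (suc n C suc j) * c (suc j) * d (n ∸ j) ≡ lower j + upper j
    pascal j _ = begin
      (suc n C suc j) * c (suc j) * d (n ∸ j)
        ≡⟨ cong (λ b → b * c (suc j) * d (n ∸ j)) (nCk+nC[k+1]≡[n+1]C[k+1] n j) ⟨
      ((n C j) + (n C suc j)) * c (suc j) * d (n ∸ j)
        ≡⟨ cong (_* d (n ∸ j)) (*-distribʳ-+ (c (suc j)) (n C j) (n C suc j)) ⟩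
      ((n C j) * c (suc j) + (n C suc j) * c (suc j)) * d (n ∸ j)
        ≡⟨ *-distribʳ-+ (d (n ∸ j)) ((n C j) * c (suc j)) ((n C suc j) * c (suc j)) ⟩
      lower j + upper j
        ∎

    drop-last : ∑ℕ shifted (suc n) ≡ (c ⋆ shift d) n
    drop-last = begin
      ∑ℕ shifted n + (n C suc n) * c (suc n) * d (n ∸ n)
        ≡⟨ cong (λ b → ∑ℕ shifted n + b * c (suc n) * d (n ∸ n)) (k>n⇒nCk≡0 (n<1+n n)) ⟩
      ∑ℕ shifted n + 0
        ≡⟨ +-identityʳ (∑ℕ shifted n) ⟩
      ∑ℕ shifted n
        ≡⟨ ∑ℕ.∑-cong n (λ k k≤n → cong (λ m → (n C k) * c k * d m) (+-∸-assoc 1 k≤n)) ⟩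
      (c ⋆ shift d) n
        ∎

  ⋆-absorb : ∀ c e n → (c ⋆ (λ m → m * e (m ∸ 1))) (suc n) ≡ suc n * (c ⋆ e) n
  ⋆-absorb c e n = begin
    ∑ℕ term n + (suc n C suc n) * c (suc n) * ((n ∸ n) * e (n ∸ n ∸ 1))
      ≡⟨ cong (λ m → ∑ℕ term n + (suc n C suc n) * c (suc n) * (m * e (m ∸ 1))) (n∸n≡0 n) ⟩
    ∑ℕ term n + (suc n C suc n) * c (suc n) * 0
      ≡⟨ cong (∑ℕ term n +_) (*-zeroʳ ((suc n C suc n) * c (suc n))) ⟩
    ∑ℕ term n + 0
      ≡⟨ +-identityʳ (∑ℕ term n) ⟩
    ∑ℕ term n
      ≡⟨ ∑ℕ.∑-cong n absorb ⟩
    ∑ℕ (λ k → suc n * ((n C k) * c k * e (n ∸ k))) n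
      ≡⟨ ∑ℕ.∑-distribˡ (suc n) (λ k → (n C k) * c k * e (n ∸ k)) n ⟨
    suc n * (c ⋆ e) n
      ∎
    where
    term : ℕ → ℕ
    term k = (suc n C k) * c k * ((suc n ∸ k) * e (suc n ∸ k ∸ 1))

    absorb : ∀ k → k ≤ n → term k ≡ suc n * ((n C k) * c k * e (n ∸ k))
    absorb k k≤n = begin
      (suc n C k) * c k * ((suc n ∸ k) * e (suc n ∸ k ∸ 1))
        ≡⟨ cong (λ m → (suc n C k) * c k * ((suc n ∸ k) * e (m ∸ 1))) (+-∸-assoc 1 k≤n) ⟩
      (suc n C k) * c k * ((suc n ∸ k) * e (n ∸ k))
        ≡⟨ regroup (suc n C k) (c k) (suc n ∸ k) (e (n ∸ k)) ⟩
      (suc n C k) * (suc n ∸ k) * c k * e (n ∸ k)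
        ≡⟨ cong (λ b → b * c k * e (n ∸ k)) (C-absorb k≤n) ⟩
      suc n * (n C k) * c k * e (n ∸ k)
        ≡⟨ regroup′ (suc n) (n C k) (c k) (e (n ∸ k)) ⟩
      suc n * ((n C k) * c k * e (n ∸ k))
        ∎
      where
      regroup : ∀ b x m y → b * x * (m * y) ≡ b * m * x * y
      regroup = solve-∀
      regroup′ : ∀ a b x y → a * b * x * y ≡ a * (b * x * y)
      regroup′ = solve-∀

  abelA : ℕ → ℕ → ℕ
  abelA x zero    = 1
  abelA x (suc m) = x * (x + suc m) ^ m

  abelB : ℕ → ℕ → ℕ
  abelB y m = (y + m) ^ m

  shift-abelA : ∀ x → shift (abelA x) ≗ (λ m → x * abelB (suc x) m)
  shift-abelA x m = cong (λ b → x * b ^ m) (+-suc x m)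

  abelB-split : ∀ y m → abelB y m ≡ abelA y m + m * abelB (suc y) (m ∸ 1)
  abelB-split y zero    = refl
  abelB-split y (suc m) = begin
    (y + suc m) * (y + suc m) ^ m                 ≡⟨ *-distribʳ-+ ((y + suc m) ^ m) y (suc m) ⟩
    y * (y + suc m) ^ m + suc m * (y + suc m) ^ m ≡⟨ cong (λ b → y * (y + suc m) ^ m + suc m * b ^ m) (+-suc y m) ⟩
    y * (y + suc m) ^ m + suc m * (suc y + m) ^ m ∎

  ⋆-abelB-suc : ∀ c n y → (c ⋆ abelB y) (suc n) ≡ (y + suc n) * (c ⋆ abelB (suc y)) n + (shift c ⋆ abelA y) n
  ⋆-abelB-suc c n y = begin
    (c ⋆ abelB y) (suc n)
      ≡⟨ ⋆-congʳ c (abelB-split y) (suc n) ⟩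
    (c ⋆ (λ m → abelA y m + m * abelB (suc y) (m ∸ 1))) (suc n)
      ≡⟨ ⋆-distribˡ-+ c (abelA y) (λ m → m * abelB (suc y) (m ∸ 1)) (suc n) ⟩
    (c ⋆ abelA y) (suc n) + (c ⋆ (λ m → m * abelB (suc y) (m ∸ 1))) (suc n)
      ≡⟨ cong₂ _+_ (⋆-leibniz c (abelA y) n) (⋆-absorb c (abelB (suc y)) n) ⟩
    ((shift c ⋆ abelA y) n + (c ⋆ shift (abelA y)) n) + suc n * S
      ≡⟨ cong (λ z → ((shift c ⋆ abelA y) n + z) + suc n * S) c⋆shift-abelA ⟩
    ((shift c ⋆ abelA y) n + y * S) + suc n * S
      ≡⟨ regroup ((shift c ⋆ abelA y) n) y (suc n) S ⟩
    (y + suc n) * S + (shift c ⋆ abelA y) n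
      ∎
    where
    S : ℕ
    S = (c ⋆ abelB (suc y)) n

    c⋆shift-abelA : (c ⋆ shift (abelA y)) n ≡ y * S
    c⋆shift-abelA = trans (⋆-congʳ c (shift-abelA y) n) (⋆-scaleʳ y c (abelB (suc y)) n)

    regroup : ∀ a y m s → (a + y * s) + m * s ≡ (y + m) * s + a
    regroup = solve-∀

  abel-identity : ∀ n x y → (abelA x ⋆ abelB y) n ≡ (x + y + n) ^ n
  abel-identity zero    x y = refl
  abel-identity (suc n) x y = begin
    (abelA x ⋆ abelB y) (suc n)
      ≡⟨ ⋆-abelB-suc (abelA x) n y ⟩
    (y + suc n) * (abelA x ⋆ abelB (suc y)) n + (shift (abelA x) ⋆ abelA y) n
      ≡⟨ cong₂ (λ u v → (y + suc n) * u + v) (abel-identity n x (suc y)) shifted ⟩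
    (y + suc n) * (x + suc y + n) ^ n + x * (y + suc x + n) ^ n
      ≡⟨ cong₂ (λ u v → (y + suc n) * u ^ n + x * v ^ n) (reassoc x y n) (reassoc′ x y n) ⟩
    (y + suc n) * (x + y + suc n) ^ n + x * (x + y + suc n) ^ n
      ≡⟨ collect y n x ((x + y + suc n) ^ n) ⟩
    (x + y + suc n) ^ suc n
      ∎
    where
    shifted : (shift (abelA x) ⋆ abelA y) n ≡ x * (y + suc x + n) ^ n
    shifted = begin
      (shift (abelA x) ⋆ abelA y) n             ≡⟨ ⋆-comm (shift (abelA x)) (abelA y) n ⟩
      (abelA y ⋆ shift (abelA x)) n             ≡⟨ ⋆-congʳ (abelA y) (shift-abelA x) n ⟩
      (abelA y ⋆ (λ m → x * abelB (suc x) m)) n ≡⟨ ⋆-scaleʳ x (abelA y) (abelB (suc x)) n ⟩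
      x * (abelA y ⋆ abelB (suc x)) n           ≡⟨ cong (x *_) (abel-identity n y (suc x)) ⟩
      x * (y + suc x + n) ^ n                   ∎
    reassoc : ∀ x y n → x + suc y + n ≡ x + y + suc n
    reassoc = solve-∀
    reassoc′ : ∀ x y n → y + suc x + n ≡ x + y + suc n
    reassoc′ = solve-∀
    collect : ∀ y n x z → (y + suc n) * z + x * z ≡ (x + y + suc n) * z
    collect = solve-∀

  tree : ℕ → ℕ
  tree zero    = 0
  tree (suc m) = suc m ^ m

  tree⋆abelB : ∀ n y → (tree ⋆ abelB y) (suc n) ≡ suc n * (y + suc n) ^ n
  tree⋆abelB n y = begin
    (tree ⋆ abelB y) (suc n)                                       ≡⟨ ⋆-abelB-suc tree n y ⟩
    (y + suc n) * (tree ⋆ abelB (suc y)) n + (abelB 1 ⋆ abelA y) n ≡⟨ cong₂ _+_ (scaled n y) last ⟩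
    n * (y + suc n) ^ n + (y + suc n) ^ n                          ≡⟨ +-comm (n * (y + suc n) ^ n) _ ⟩
    suc n * (y + suc n) ^ n                                        ∎
    where
    last : (abelB 1 ⋆ abelA y) n ≡ (y + suc n) ^ n
    last = begin
      (abelB 1 ⋆ abelA y) n ≡⟨ ⋆-comm (abelB 1) (abelA y) n ⟩
      (abelA y ⋆ abelB 1) n ≡⟨ abel-identity n y 1 ⟩
      (y + 1 + n) ^ n       ≡⟨ cong (_^ n) (+-assoc y 1 n) ⟩
      (y + suc n) ^ n       ∎

    scaled : ∀ n y → (y + suc n) * (tree ⋆ abelB (suc y)) n ≡ n * (y + suc n) ^ n
    scaled zero    y = *-zeroʳ (y + 1)
    scaled (suc m) y = begin
      (y + suc (suc m)) * (tree ⋆ abelB (suc y)) (suc m)  ≡⟨ cong ((y + suc (suc m)) *_) (tree⋆abelB m (suc y)) ⟩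
      (y + suc (suc m)) * (suc m * (suc y + suc m) ^ m)   ≡⟨ cong (λ b → (y + suc (suc m)) * (suc m * b ^ m)) (+-suc y (suc m)) ⟨
      (y + suc (suc m)) * (suc m * (y + suc (suc m)) ^ m) ≡⟨ ℕ*.x∙yz≈y∙xz (y + suc (suc m)) (suc m) _ ⟩
      suc m * (y + suc (suc m)) ^ suc m                   ∎

  tree-convolution : ∀ n → (tree ⋆ (λ m → m * tree m)) n + tree n ≡ n * tree n
  tree-convolution zero    = refl
  tree-convolution (suc n) = begin
    (∑ℕ term n + (suc n C suc n) * tree (suc n) * ((n ∸ n) * tree (n ∸ n))) + tree (suc n)
      ≡⟨ cong (λ m → (∑ℕ term n + (suc n C suc n) * tree (suc n) * (m * tree m)) + tree (suc n)) (n∸n≡0 n) ⟩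
    (∑ℕ term n + (suc n C suc n) * tree (suc n) * 0) + tree (suc n)
      ≡⟨ cong (λ z → (∑ℕ term n + z) + tree (suc n)) (*-zeroʳ ((suc n C suc n) * tree (suc n))) ⟩
    (∑ℕ term n + 0) + tree (suc n)
      ≡⟨ cong (_+ tree (suc n)) (+-identityʳ (∑ℕ term n)) ⟩
    ∑ℕ term n + tree (suc n)
      ≡⟨ cong₂ _+_ (∑ℕ.∑-cong n via-abelB0) diagonal ⟨
    (tree ⋆ abelB 0) (suc n)
      ≡⟨ tree⋆abelB n 0 ⟩
    suc n * tree (suc n)
      ∎
    where
    term : ℕ → ℕ
    term k = (suc n C k) * tree k * ((suc n ∸ k) * tree (suc n ∸ k))

    m*tree[m]≡abelB0 : ∀ m → 1 ≤ m → m * tree m ≡ abelB 0 m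
    m*tree[m]≡abelB0 (suc m) _ = refl

    via-abelB0 : ∀ k → k ≤ n → (suc n C k) * tree k * abelB 0 (suc n ∸ k) ≡ term k
    via-abelB0 k k≤n = cong ((suc n C k) * tree k *_) (sym (m*tree[m]≡abelB0 (suc n ∸ k) (m<n⇒0<n∸m (s≤s k≤n))))

    diagonal : (suc n C suc n) * tree (suc n) * abelB 0 (n ∸ n) ≡ tree (suc n)
    diagonal = begin
      (suc n C suc n) * tree (suc n) * abelB 0 (n ∸ n) ≡⟨ cong₂ (λ b m → b * tree (suc n) * abelB 0 m) (nCn≡1 (suc n)) (n∸n≡0 n) ⟩
      1 * tree (suc n) * 1                             ≡⟨ *-identityʳ (1 * tree (suc n)) ⟩
      1 * tree (suc n)                                 ≡⟨ *-identityˡ (tree (suc n)) ⟩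
      tree (suc n)                                     ∎

open BinomialConvolution using (∑ℕ; _⋆_; tree; C-factorial; tree-convolution)

module RationalCasts where

  open import Data.Integer as ℤ using (+_)
  import Data.Integer.Properties as ℤP
  import Data.Integer.Tactic.RingSolver as ℤ-Solver
  open import Data.Rational using (_/_; toℚᵘ)
  open import Data.Rational.Properties using (toℚᵘ-injective; toℚᵘ-fromℚᵘ; toℚᵘ-homo-+; toℚᵘ-homo-*)
  open import Data.Rational.Unnormalised as ℚᵘ using (mkℚᵘ; *≡*)
  import Data.Rational.Unnormalised.Properties as ℚᵘP

  toℚᵘ-/ : ∀ a d → toℚᵘ (+ a / suc d) ℚᵘ.≃ mkℚᵘ (+ a) d
  toℚᵘ-/ a d = toℚᵘ-fromℚᵘ (mkℚᵘ (+ a) d)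

  ℚn-+ : ∀ a b → ℚn (a + b) ≡ ℚn a ℚ.+ ℚn b
  ℚn-+ a b = toℚᵘ-injective (begin
    toℚᵘ (ℚn (a + b))              ≈⟨ toℚᵘ-/ (a + b) 0 ⟩
    mkℚᵘ (+ (a + b)) 0             ≈⟨ *≡* (trans (cong (ℤ._* + 1) (ℤP.pos-+ a b)) (sum-of-integers (+ a) (+ b))) ⟩
    mkℚᵘ (+ a) 0 ℚᵘ.+ mkℚᵘ (+ b) 0 ≈⟨ ℚᵘP.+-cong (toℚᵘ-/ a 0) (toℚᵘ-/ b 0) ⟨
    toℚᵘ (ℚn a) ℚᵘ.+ toℚᵘ (ℚn b)   ≈⟨ toℚᵘ-homo-+ (ℚn a) (ℚn b) ⟨
    toℚᵘ (ℚn a ℚ.+ ℚn b)            ∎)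
    where
    open ℚᵘP.≃-Reasoning
    sum-of-integers : ∀ x y → (x ℤ.+ y) ℤ.* + 1 ≡ (x ℤ.* + 1 ℤ.+ y ℤ.* + 1) ℤ.* + 1
    sum-of-integers = ℤ-Solver.solve-∀

  ℚn-* : ∀ a b → ℚn (a * b) ≡ ℚn a ℚ.* ℚn b
  ℚn-* a b = toℚᵘ-injective (begin
    toℚᵘ (ℚn (a * b))              ≈⟨ toℚᵘ-/ (a * b) 0 ⟩
    mkℚᵘ (+ (a * b)) 0             ≈⟨ *≡* (cong (ℤ._* + 1) (ℤP.pos-* a b)) ⟩
    mkℚᵘ (+ a) 0 ℚᵘ.* mkℚᵘ (+ b) 0 ≈⟨ ℚᵘP.*-cong (toℚᵘ-/ a 0) (toℚᵘ-/ b 0) ⟨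
    toℚᵘ (ℚn a) ℚᵘ.* toℚᵘ (ℚn b)   ≈⟨ toℚᵘ-homo-* (ℚn a) (ℚn b) ⟨
    toℚᵘ (ℚn a ℚ.* ℚn b)            ∎)
    where open ℚᵘP.≃-Reasoning

  /-*-denominator : ∀ a d .{{_ : NonZero d}} → (+ a / d) ℚ.* ℚn d ≡ ℚn a
  /-*-denominator a (suc d) = toℚᵘ-injective (begin
    toℚᵘ ((+ a / suc d) ℚ.* ℚn (suc d))       ≈⟨ toℚᵘ-homo-* (+ a / suc d) (ℚn (suc d)) ⟩
    toℚᵘ (+ a / suc d) ℚᵘ.* toℚᵘ (ℚn (suc d)) ≈⟨ ℚᵘP.*-cong (toℚᵘ-/ a d) (toℚᵘ-/ (suc d) 0) ⟩
    mkℚᵘ (+ a) d ℚᵘ.* mkℚᵘ (+ suc d) 0        ≈⟨ *≡* cancel ⟩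
    mkℚᵘ (+ a) 0                              ≈⟨ toℚᵘ-/ a 0 ⟨
    toℚᵘ (ℚn a)                             ∎)
    where
    open ℚᵘP.≃-Reasoning
    cancel : + a ℤ.* + suc d ℤ.* + 1 ≡ + a ℤ.* + suc (d * 1)
    cancel = trans (ℤP.*-identityʳ (+ a ℤ.* + suc d)) (cong (λ m → + a ℤ.* + suc m) (sym (ℕP.*-identityʳ d)))

  ℚn-∑ : ∀ f n → ℚn (∑ℕ f n) ≡ sumUpTo (ℚn ∘ f) n
  ℚn-∑ f zero    = refl
  ℚn-∑ f (suc n) = trans (ℚn-+ (∑ℕ f n) (f (suc n))) (cong (ℚ._+ ℚn (f (suc n))) (ℚn-∑ f n))

  *-cancelʳ-ℚn : ∀ {p q} d .{{_ : NonZero d}} → p ℚ.* ℚn d ≡ q ℚ.* ℚn d → p ≡ q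
  *-cancelʳ-ℚn {p} {q} d eq = begin
    p                            ≡⟨ ℚP.*-identityʳ p ⟨
    p ℚ.* 1ℚ                     ≡⟨ cong (p ℚ.*_) inverse ⟨
    p ℚ.* (ℚn d ℚ.* (+ 1 ℚ./ d)) ≡⟨ ℚP.*-assoc p (ℚn d) _ ⟨
    p ℚ.* ℚn d ℚ.* (+ 1 ℚ./ d)   ≡⟨ cong (ℚ._* (+ 1 ℚ./ d)) eq ⟩
    q ℚ.* ℚn d ℚ.* (+ 1 ℚ./ d)   ≡⟨ ℚP.*-assoc q (ℚn d) _ ⟩
    q ℚ.* (ℚn d ℚ.* (+ 1 ℚ./ d)) ≡⟨ cong (q ℚ.*_) inverse ⟩
    q ℚ.* 1ℚ                     ≡⟨ ℚP.*-identityʳ q ⟩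
    q                            ∎
    where
    open ≡-Reasoning
    inverse : ℚn d ℚ.* (+ 1 ℚ./ d) ≡ 1ℚ
    inverse = trans (ℚP.*-comm (ℚn d) (+ 1 ℚ./ d)) (/-*-denominator 1 d)

open RationalCasts

module PowerSeries where

  open ≡-Reasoning

  module ∑ℚ = RangeSum.Properties (CommutativeRing.commutativeSemiring ℚP.+-*-commutativeRing)
    sumUpTo (λ _ → refl) (λ _ _ → refl)

  infixl 6 _+S_

  _+S_ : Series → Series → Series
  (A +S B) n = A n ℚ.+ B n

  ⊛-cong : ∀ {A A′ B B′} → A ≗ A′ → B ≗ B′ → A ⊛ B ≗ A′ ⊛ B′
  ⊛-cong A≗A′ B≗B′ n = ∑ℚ.∑-cong n (λ i _ → cong₂ ℚ._*_ (A≗A′ i) (B≗B′ (n ∸ i)))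

  ⊛-congˡ : ∀ A {B B′} → B ≗ B′ → A ⊛ B ≗ A ⊛ B′
  ⊛-congˡ A = ⊛-cong {A} (λ _ → refl)

  ⊛-congʳ : ∀ {A A′} B → A ≗ A′ → A ⊛ B ≗ A′ ⊛ B
  ⊛-congʳ B A≗A′ = ⊛-cong {B = B} A≗A′ (λ _ → refl)

  ⊛-comm : ∀ A B → A ⊛ B ≗ B ⊛ A
  ⊛-comm A B n = trans (∑ℚ.∑-reverse _ n) (∑ℚ.∑-cong n reversed)
    where
    reversed : ∀ i → i ≤ n → A (n ∸ i) ℚ.* B (n ∸ (n ∸ i)) ≡ B i ℚ.* A (n ∸ i)
    reversed i i≤n = trans (cong (λ j → A (n ∸ i) ℚ.* B j) (ℕP.m∸[m∸n]≡n i≤n)) (ℚP.*-comm (A (n ∸ i)) (B i))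

  ⊛-assoc : ∀ A B C → (A ⊛ B) ⊛ C ≗ A ⊛ (B ⊛ C)
  ⊛-assoc A B C n = begin
    sumUpTo (λ i → sumUpTo (λ j → A j ℚ.* B (i ∸ j)) i ℚ.* C (n ∸ i)) n
      ≡⟨ ∑ℚ.∑-cong n (λ i _ → ∑ℚ.∑-distribʳ (C (n ∸ i)) _ i) ⟩
    sumUpTo (λ i → sumUpTo (λ j → A j ℚ.* B (i ∸ j) ℚ.* C (n ∸ i)) i) n
      ≡⟨ ∑ℚ.∑-triangle (λ i j → A j ℚ.* B (i ∸ j) ℚ.* C (n ∸ i)) n ⟩
    sumUpTo (λ j → sumUpTo (λ l → A j ℚ.* B (j + l ∸ j) ℚ.* C (n ∸ (j + l))) (n ∸ j)) n
      ≡⟨ ∑ℚ.∑-cong n (λ j _ → ∑ℚ.∑-cong (n ∸ j) (λ l _ → reindex j l)) ⟩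
    sumUpTo (λ j → sumUpTo (λ l → A j ℚ.* (B l ℚ.* C (n ∸ j ∸ l))) (n ∸ j)) n
      ≡⟨ ∑ℚ.∑-cong n (λ j _ → ∑ℚ.∑-distribˡ (A j) _ (n ∸ j)) ⟨
    sumUpTo (λ j → A j ℚ.* sumUpTo (λ l → B l ℚ.* C (n ∸ j ∸ l)) (n ∸ j)) n
      ∎
    where
    reindex : ∀ j l → A j ℚ.* B (j + l ∸ j) ℚ.* C (n ∸ (j + l)) ≡ A j ℚ.* (B l ℚ.* C (n ∸ j ∸ l))
    reindex j l = trans (cong₂ (λ p q → A j ℚ.* B p ℚ.* C q) (ℕP.m+n∸m≡n j l) (sym (ℕP.∸-+-assoc n j l)))
                        (ℚP.*-assoc (A j) (B l) (C (n ∸ j ∸ l)))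

  ⊛-identityˡ : ∀ A → oneS ⊛ A ≗ A
  ⊛-identityˡ A zero    = ℚP.*-identityˡ (A 0)
  ⊛-identityˡ A (suc n) = begin
    (oneS ⊛ A) (suc n) ≡⟨ ∑ℚ.∑-head _ n ⟩
    1ℚ ℚ.* A (suc n) ℚ.+ sumUpTo (λ i → 0ℚ ℚ.* A (n ∸ i)) n
      ≡⟨ cong₂ ℚ._+_ (ℚP.*-identityˡ (A (suc n))) (∑ℚ.∑-zeros _ n (λ i _ → ℚP.*-zeroˡ (A (n ∸ i)))) ⟩
    A (suc n) ℚ.+ 0ℚ ≡⟨ ℚP.+-identityʳ (A (suc n)) ⟩
    A (suc n)        ∎

  ⊛-identityʳ : ∀ A → A ⊛ oneS ≗ A
  ⊛-identityʳ A n = trans (⊛-comm A oneS n) (⊛-identityˡ A n)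

  ⊛-distribˡ-+S : ∀ A B C → A ⊛ (B +S C) ≗ A ⊛ B +S A ⊛ C
  ⊛-distribˡ-+S A B C n =
    trans (∑ℚ.∑-cong n (λ i _ → ℚP.*-distribˡ-+ (A i) (B (n ∸ i)) (C (n ∸ i)))) (∑ℚ.∑-distrib-+ _ _ n)

  ⊛-distribʳ-+S : ∀ A B C → (B +S C) ⊛ A ≗ B ⊛ A +S C ⊛ A
  ⊛-distribʳ-+S A B C n = begin
    ((B +S C) ⊛ A) n        ≡⟨ ⊛-comm (B +S C) A n ⟩
    (A ⊛ (B +S C)) n        ≡⟨ ⊛-distribˡ-+S A B C n ⟩
    (A ⊛ B) n ℚ.+ (A ⊛ C) n ≡⟨ cong₂ ℚ._+_ (⊛-comm A B n) (⊛-comm A C n) ⟩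
    (B ⊛ A) n ℚ.+ (C ⊛ A) n ∎

  scale-⊛ : ∀ c A B → scale c A ⊛ B ≗ scale c (A ⊛ B)
  scale-⊛ c A B n = trans (∑ℚ.∑-cong n (λ i _ → ℚP.*-assoc c (A i) (B (n ∸ i)))) (sym (∑ℚ.∑-distribˡ c _ n))

  ⊛-scale : ∀ c A B → A ⊛ scale c B ≗ scale c (A ⊛ B)
  ⊛-scale c A B n = begin
    (A ⊛ scale c B) n ≡⟨ ⊛-comm A (scale c B) n ⟩
    (scale c B ⊛ A) n ≡⟨ scale-⊛ c B A n ⟩
    c ℚ.* (B ⊛ A) n   ≡⟨ cong (c ℚ.*_) (⊛-comm B A n) ⟩
    c ℚ.* (A ⊛ B) n   ∎

  ⊛-left-comm : ∀ A B C → A ⊛ (B ⊛ C) ≗ B ⊛ (A ⊛ C)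
  ⊛-left-comm A B C n = begin
    (A ⊛ (B ⊛ C)) n ≡⟨ ⊛-assoc A B C n ⟨
    ((A ⊛ B) ⊛ C) n ≡⟨ ⊛-congʳ C (⊛-comm A B) n ⟩
    ((B ⊛ A) ⊛ C) n ≡⟨ ⊛-assoc B A C n ⟩
    (B ⊛ (A ⊛ C)) n ∎

  powS-+ : ∀ A a b → powS A (a + b) ≗ powS A a ⊛ powS A b
  powS-+ A zero    b n = sym (⊛-identityˡ (powS A b) n)
  powS-+ A (suc a) b n = trans (⊛-congˡ A (powS-+ A a b) n) (sym (⊛-assoc A (powS A a) (powS A b) n))

  θ-cong : ∀ {A B} → A ≗ B → theta A ≗ theta B
  θ-cong A≗B n = cong (ℚn n ℚ.*_) (A≗B n)

  θ-+S : ∀ A B → theta (A +S B) ≗ theta A +S theta B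
  θ-+S A B n = ℚP.*-distribˡ-+ (ℚn n) (A n) (B n)

  θ-oneS : theta oneS ≗ zeroS
  θ-oneS zero    = refl
  θ-oneS (suc n) = ℚP.*-zeroʳ (ℚn (suc n))

  θ-leibniz : ∀ A B → theta (A ⊛ B) ≗ theta A ⊛ B +S A ⊛ theta B
  θ-leibniz A B n = begin
    ℚn n ℚ.* sumUpTo (λ i → A i ℚ.* B (n ∸ i)) n   ≡⟨ ∑ℚ.∑-distribˡ (ℚn n) _ n ⟩
    sumUpTo (λ i → ℚn n ℚ.* (A i ℚ.* B (n ∸ i))) n ≡⟨ ∑ℚ.∑-cong n split ⟩
    sumUpTo (λ i → ℚn i ℚ.* A i ℚ.* B (n ∸ i) ℚ.+ A i ℚ.* (ℚn (n ∸ i) ℚ.* B (n ∸ i))) n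
                                                             ≡⟨ ∑ℚ.∑-distrib-+ _ _ n ⟩
    (theta A ⊛ B +S A ⊛ theta B) n                           ∎
    where
    split : ∀ i → i ≤ n →
            ℚn n ℚ.* (A i ℚ.* B (n ∸ i)) ≡ ℚn i ℚ.* A i ℚ.* B (n ∸ i) ℚ.+ A i ℚ.* (ℚn (n ∸ i) ℚ.* B (n ∸ i))
    split i i≤n = begin
      ℚn n ℚ.* (A i ℚ.* B (n ∸ i))                  ≡⟨ cong (λ m → ℚn m ℚ.* (A i ℚ.* B (n ∸ i))) n≡i+[n∸i] ⟩
      ℚn (i + (n ∸ i)) ℚ.* (A i ℚ.* B (n ∸ i))      ≡⟨ cong (ℚ._* (A i ℚ.* B (n ∸ i))) (ℚn-+ i (n ∸ i)) ⟩
      (ℚn i ℚ.+ ℚn (n ∸ i)) ℚ.* (A i ℚ.* B (n ∸ i)) ≡⟨ ℚP.*-distribʳ-+ _ (ℚn i) (ℚn (n ∸ i)) ⟩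
      ℚn i ℚ.* (A i ℚ.* B (n ∸ i)) ℚ.+ ℚn (n ∸ i) ℚ.* (A i ℚ.* B (n ∸ i))
        ≡⟨ cong₂ ℚ._+_ (sym (ℚP.*-assoc (ℚn i) (A i) (B (n ∸ i)))) (ℚ*.x∙yz≈y∙xz (ℚn (n ∸ i)) (A i) (B (n ∸ i))) ⟩
      ℚn i ℚ.* A i ℚ.* B (n ∸ i) ℚ.+ A i ℚ.* (ℚn (n ∸ i) ℚ.* B (n ∸ i)) ∎
      where
      n≡i+[n∸i] : n ≡ i + (n ∸ i)
      n≡i+[n∸i] = sym (ℕP.m+[n∸m]≡n i≤n)

open PowerSeries

module ExponentialGeneratingFunction where

  open import Data.Nat.Combinatorics using (_C_)
  open ≡-Reasoning

  egf : (ℕ → ℕ) → Series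
  egf c n = over! (c n) n

  egf-*-! : ∀ c n → egf c n ℚ.* ℚn (n !) ≡ ℚn (c n)
  egf-*-! c n = /-*-denominator (c n) (n !) {{ℕP._!≢0 n}}

  egf-unique : ∀ {x} c n → x ℚ.* ℚn (n !) ≡ ℚn (c n) → x ≡ egf c n
  egf-unique c n eq = *-cancelʳ-ℚn (n !) {{ℕP._!≢0 n}} (trans eq (sym (egf-*-! c n)))

  egf-+ : ∀ c d → egf (λ n → c n + d n) ≗ egf c +S egf d
  egf-+ c d n = sym (egf-unique (λ n → c n + d n) n (begin
    (egf c n ℚ.+ egf d n) ℚ.* ℚn (n !)            ≡⟨ ℚP.*-distribʳ-+ (ℚn (n !)) (egf c n) (egf d n) ⟩
    egf c n ℚ.* ℚn (n !) ℚ.+ egf d n ℚ.* ℚn (n !) ≡⟨ cong₂ ℚ._+_ (egf-*-! c n) (egf-*-! d n) ⟩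
    ℚn (c n) ℚ.+ ℚn (d n)                         ≡⟨ ℚn-+ (c n) (d n) ⟨
    ℚn (c n + d n)                               ∎))

  θ-egf : ∀ c → theta (egf c) ≗ egf (λ n → n * c n)
  θ-egf c n = egf-unique (λ n → n * c n) n (begin
    ℚn n ℚ.* egf c n ℚ.* ℚn (n !)   ≡⟨ ℚP.*-assoc (ℚn n) (egf c n) (ℚn (n !)) ⟩
    ℚn n ℚ.* (egf c n ℚ.* ℚn (n !)) ≡⟨ cong (ℚn n ℚ.*_) (egf-*-! c n) ⟩
    ℚn n ℚ.* ℚn (c n)               ≡⟨ ℚn-* n (c n) ⟨
    ℚn (n * c n)                   ∎)

  egf-⋆ : ∀ c d → egf c ⊛ egf d ≗ egf (c ⋆ d)
  egf-⋆ c d n = egf-unique (c ⋆ d) n (begin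
    (egf c ⊛ egf d) n ℚ.* ℚn (n !)
      ≡⟨ ∑ℚ.∑-distribʳ (ℚn (n !)) _ n ⟩
    sumUpTo (λ k → egf c k ℚ.* egf d (n ∸ k) ℚ.* ℚn (n !)) n
      ≡⟨ ∑ℚ.∑-cong n term ⟩
    sumUpTo (λ k → ℚn ((n C k) * c k * d (n ∸ k))) n
      ≡⟨ ℚn-∑ (λ k → (n C k) * c k * d (n ∸ k)) n ⟨
    ℚn ((c ⋆ d) n)
      ∎)
    where
    term : ∀ k → k ≤ n → egf c k ℚ.* egf d (n ∸ k) ℚ.* ℚn (n !) ≡ ℚn ((n C k) * c k * d (n ∸ k))
    term k k≤n = begin
      egf c k ℚ.* egf d (n ∸ k) ℚ.* ℚn (n !)
        ≡⟨ cong (λ m → egf c k ℚ.* egf d (n ∸ k) ℚ.* ℚn m) (C-factorial k≤n) ⟨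
      egf c k ℚ.* egf d (n ∸ k) ℚ.* ℚn ((n C k) * (k ! * (n ∸ k) !))
        ≡⟨ cong (egf c k ℚ.* egf d (n ∸ k) ℚ.*_) (trans (ℚn-* (n C k) _) (cong (ℚn (n C k) ℚ.*_) (ℚn-* (k !) ((n ∸ k) !)))) ⟩
      egf c k ℚ.* egf d (n ∸ k) ℚ.* (ℚn (n C k) ℚ.* (ℚn (k !) ℚ.* ℚn ((n ∸ k) !)))
        ≡⟨ regroup (egf c k) (egf d (n ∸ k)) (ℚn (n C k)) (ℚn (k !)) (ℚn ((n ∸ k) !)) ⟩
      ℚn (n C k) ℚ.* (egf c k ℚ.* ℚn (k !)) ℚ.* (egf d (n ∸ k) ℚ.* ℚn ((n ∸ k) !))
        ≡⟨ cong₂ (λ u v → ℚn (n C k) ℚ.* u ℚ.* v) (egf-*-! c k) (egf-*-! d (n ∸ k)) ⟩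
      ℚn (n C k) ℚ.* ℚn (c k) ℚ.* ℚn (d (n ∸ k))
        ≡⟨ trans (ℚn-* ((n C k) * c k) (d (n ∸ k))) (cong (ℚ._* ℚn (d (n ∸ k))) (ℚn-* (n C k) (c k))) ⟨
      ℚn ((n C k) * c k * d (n ∸ k))
        ∎
      where
      open +-*-Solver
      regroup : ∀ x y b u v → x ℚ.* y ℚ.* (b ℚ.* (u ℚ.* v)) ≡ b ℚ.* (x ℚ.* u) ℚ.* (y ℚ.* v)
      regroup = solve 5 (λ x y b u v → x :* y :* (b :* (u :* v)) := b :* (x :* u) :* (y :* v)) refl

open ExponentialGeneratingFunction

module TreeFunction where

  open import Data.Nat.Induction using (<-rec)
  open ≡-Reasoning

  Tz≗egf-tree : Tz ≗ egf tree
  Tz≗egf-tree zero    = refl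
  Tz≗egf-tree (suc n) = refl

  θTz≗Tz+Tz⊛θTz : theta Tz ≗ Tz +S Tz ⊛ theta Tz
  θTz≗Tz+Tz⊛θTz n = begin
    theta Tz n                              ≡⟨ θTz≗egf-θtree n ⟩
    egf θtree n                             ≡⟨ cong (λ a → over! a n) (tree-convolution n) ⟨
    egf (λ m → (tree ⋆ θtree) m + tree m) n ≡⟨ egf-+ (tree ⋆ θtree) tree n ⟩
    egf (tree ⋆ θtree) n ℚ.+ egf tree n     ≡⟨ ℚP.+-comm _ (egf tree n) ⟩
    egf tree n ℚ.+ egf (tree ⋆ θtree) n     ≡⟨ cong (egf tree n ℚ.+_) (egf-⋆ tree θtree n) ⟨
    egf tree n ℚ.+ (egf tree ⊛ egf θtree) n ≡⟨ cong₂ ℚ._+_ (Tz≗egf-tree n) (⊛-cong Tz≗egf-tree θTz≗egf-θtree n) ⟨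
    Tz n ℚ.+ (Tz ⊛ theta Tz) n              ∎
    where
    θtree : ℕ → ℕ
    θtree m = m * tree m

    θTz≗egf-θtree : theta Tz ≗ egf θtree
    θTz≗egf-θtree m = trans (θ-cong Tz≗egf-tree m) (θ-egf tree m)

  ∸-suc-< : ∀ {i n} → suc i ≤ n → n ∸ suc i < n
  ∸-suc-< {i} {n} 1+i≤n = ℕP.∸-monoʳ-< {n} {suc i} {0} (s≤s z≤n) 1+i≤n

  module _ (F : Series) (F0≡0 : F 0 ≡ 0ℚ) where

    F0*q≡0 : ∀ q → F 0 ℚ.* q ≡ 0ℚ
    F0*q≡0 q = trans (cong (ℚ._* q) F0≡0) (ℚP.*-zeroˡ q)

    powS-vanishes : ∀ j n → n < j → powS F j n ≡ 0ℚ
    powS-vanishes (suc j) n (s≤s n≤j) = ∑ℚ.∑-zeros _ n term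
      where
      term : ∀ i → i ≤ n → F i ℚ.* powS F j (n ∸ i) ≡ 0ℚ
      term zero    _     = F0*q≡0 (powS F j n)
      term (suc i) 1+i≤n = begin
        F (suc i) ℚ.* powS F j (n ∸ suc i) ≡⟨ cong (F (suc i) ℚ.*_) (powS-vanishes j (n ∸ suc i) n∸[1+i]<j) ⟩
        F (suc i) ℚ.* 0ℚ                   ≡⟨ ℚP.*-zeroʳ (F (suc i)) ⟩
        0ℚ                                 ∎
        where
        n∸[1+i]<j : n ∸ suc i < j
        n∸[1+i]<j = ℕP.<-≤-trans (∸-suc-< 1+i≤n) n≤j

    ⊛-fixpoint-unique : ∀ A {X Y} → X ≗ A +S F ⊛ X → Y ≗ A +S F ⊛ Y → X ≗ Y
    ⊛-fixpoint-unique A {X} {Y} X≗ Y≗ = <-rec (λ n → X n ≡ Y n) agree-at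
      where
      agree-at : ∀ n → (∀ {m} → m < n → X m ≡ Y m) → X n ≡ Y n
      agree-at n X≡Y-below = begin
        X n               ≡⟨ X≗ n ⟩
        A n ℚ.+ (F ⊛ X) n ≡⟨ cong (A n ℚ.+_) (∑ℚ.∑-cong n term) ⟩
        A n ℚ.+ (F ⊛ Y) n ≡⟨ Y≗ n ⟨
        Y n               ∎
        where
        term : ∀ i → i ≤ n → F i ℚ.* X (n ∸ i) ≡ F i ℚ.* Y (n ∸ i)
        term zero    _     = trans (F0*q≡0 (X n)) (sym (F0*q≡0 (Y n)))
        term (suc i) 1+i≤n = cong (F (suc i) ℚ.*_) (X≡Y-below (∸-suc-< 1+i≤n))

  I : Series
  I = invOneMinusT

  I≗1+Tz⊛I : I ≗ oneS +S Tz ⊛ I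
  I≗1+Tz⊛I n = sym (begin
    oneS n ℚ.+ sumUpTo (λ i → Tz i ℚ.* I (n ∸ i)) n
      ≡⟨ cong (oneS n ℚ.+_) (∑ℚ.∑-cong n (λ i _ → cong (Tz i ℚ.*_) (truncate (n ∸ i) n (ℕP.m∸n≤m n i)))) ⟩
    oneS n ℚ.+ sumUpTo (λ i → Tz i ℚ.* sumUpTo (λ j → powS Tz j (n ∸ i)) n) n
      ≡⟨ cong (oneS n ℚ.+_) (∑ℚ.∑-cong n (λ i _ → ∑ℚ.∑-distribˡ (Tz i) _ n)) ⟩
    oneS n ℚ.+ sumUpTo (λ i → sumUpTo (λ j → Tz i ℚ.* powS Tz j (n ∸ i)) n) n
      ≡⟨ cong (oneS n ℚ.+_) (∑ℚ.∑-comm (λ i j → Tz i ℚ.* powS Tz j (n ∸ i)) n n) ⟩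
    oneS n ℚ.+ sumUpTo (λ j → powS Tz (suc j) n) n
      ≡⟨ ∑ℚ.∑-head (λ j → powS Tz j n) n ⟨
    sumUpTo (λ j → powS Tz j n) (suc n)
      ≡⟨ truncate n (suc n) (ℕP.n≤1+n n) ⟨
    I n
      ∎)
    where
    truncate : ∀ m N → m ≤ N → I m ≡ sumUpTo (λ j → powS Tz j m) N
    truncate m N m≤N = sym (∑ℚ.∑-extend (λ j → powS Tz j m) m N m≤N (λ j m<j → powS-vanishes Tz refl j m m<j))

  Tz⊛I≗Tz+Tz⊛[Tz⊛I] : Tz ⊛ I ≗ Tz +S Tz ⊛ (Tz ⊛ I)
  Tz⊛I≗Tz+Tz⊛[Tz⊛I] n = begin
    (Tz ⊛ I) n                          ≡⟨ ⊛-congˡ Tz I≗1+Tz⊛I n ⟩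
    (Tz ⊛ (oneS +S Tz ⊛ I)) n           ≡⟨ ⊛-distribˡ-+S Tz oneS (Tz ⊛ I) n ⟩
    (Tz ⊛ oneS) n ℚ.+ (Tz ⊛ (Tz ⊛ I)) n ≡⟨ cong (ℚ._+ (Tz ⊛ (Tz ⊛ I)) n) (⊛-identityʳ Tz n) ⟩
    Tz n ℚ.+ (Tz ⊛ (Tz ⊛ I)) n          ∎

  θTz≗Tz⊛I : theta Tz ≗ Tz ⊛ I
  θTz≗Tz⊛I = ⊛-fixpoint-unique Tz refl Tz θTz≗Tz+Tz⊛θTz Tz⊛I≗Tz+Tz⊛[Tz⊛I]

  powS-I-suc : ∀ m → powS I (suc m) ≗ powS I m +S Tz ⊛ powS I (suc m)
  powS-I-suc m n = begin
    (I ⊛ powS I m) n                                ≡⟨ ⊛-congʳ (powS I m) I≗1+Tz⊛I n ⟩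
    ((oneS +S Tz ⊛ I) ⊛ powS I m) n                 ≡⟨ ⊛-distribʳ-+S (powS I m) oneS (Tz ⊛ I) n ⟩
    (oneS ⊛ powS I m) n ℚ.+ ((Tz ⊛ I) ⊛ powS I m) n ≡⟨ cong₂ ℚ._+_ (⊛-identityˡ (powS I m) n) (⊛-assoc Tz I (powS I m) n) ⟩
    powS I m n ℚ.+ (Tz ⊛ powS I (suc m)) n          ∎

  θI≗Tz⊛I³ : theta I ≗ Tz ⊛ powS I 3
  θI≗Tz⊛I³ = ⊛-fixpoint-unique Tz refl (Tz ⊛ powS I 2) θI-equation Tz⊛I³-equation
    where
    θI-equation : theta I ≗ Tz ⊛ powS I 2 +S Tz ⊛ theta I
    θI-equation n = begin
      theta I n
        ≡⟨ θ-cong I≗1+Tz⊛I n ⟩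
      theta (oneS +S Tz ⊛ I) n
        ≡⟨ θ-+S oneS (Tz ⊛ I) n ⟩
      theta oneS n ℚ.+ theta (Tz ⊛ I) n
        ≡⟨ cong₂ ℚ._+_ (θ-oneS n) (θ-leibniz Tz I n) ⟩
      0ℚ ℚ.+ ((theta Tz ⊛ I) n ℚ.+ (Tz ⊛ theta I) n)
        ≡⟨ ℚP.+-identityˡ _ ⟩
      (theta Tz ⊛ I) n ℚ.+ (Tz ⊛ theta I) n
        ≡⟨ cong (ℚ._+ (Tz ⊛ theta I) n) (trans (⊛-congʳ I θTz≗Tz⊛I n) (⊛-assoc Tz I I n)) ⟩
      (Tz ⊛ (I ⊛ I)) n ℚ.+ (Tz ⊛ theta I) n
        ≡⟨ cong (ℚ._+ (Tz ⊛ theta I) n) (⊛-congˡ Tz (⊛-congˡ I (⊛-identityʳ I)) n) ⟨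
      (Tz ⊛ powS I 2) n ℚ.+ (Tz ⊛ theta I) n
        ∎

    Tz⊛I³-equation : Tz ⊛ powS I 3 ≗ Tz ⊛ powS I 2 +S Tz ⊛ (Tz ⊛ powS I 3)
    Tz⊛I³-equation n = trans (⊛-congˡ Tz (powS-I-suc 2) n) (⊛-distribˡ-+S Tz (powS I 2) (Tz ⊛ powS I 3) n)

  θ-powS-I : ∀ m → theta (powS I m) ≗ scale (ℚn m) (Tz ⊛ powS I (m + 2))
  θ-powS-I zero    n = trans (θ-oneS n) (sym (ℚP.*-zeroˡ ((Tz ⊛ powS I 2) n)))
  θ-powS-I (suc m) n = begin
    theta (I ⊛ powS I m) n                              ≡⟨ θ-leibniz I (powS I m) n ⟩
    (theta I ⊛ powS I m) n ℚ.+ (I ⊛ theta (powS I m)) n ≡⟨ cong₂ ℚ._+_ from-θI from-θIᵐ ⟩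
    Z n ℚ.+ ℚn m ℚ.* Z n                                ≡⟨ cong (ℚ._+ ℚn m ℚ.* Z n) (ℚP.*-identityˡ (Z n)) ⟨
    1ℚ ℚ.* Z n ℚ.+ ℚn m ℚ.* Z n                         ≡⟨ ℚP.*-distribʳ-+ (Z n) 1ℚ (ℚn m) ⟨
    (1ℚ ℚ.+ ℚn m) ℚ.* Z n                               ≡⟨ cong (ℚ._* Z n) (ℚn-+ 1 m) ⟨
    ℚn (suc m) ℚ.* Z n                                  ∎
    where
    Z : Series
    Z = Tz ⊛ powS I (suc m + 2)

    from-θI : (theta I ⊛ powS I m) n ≡ Z n
    from-θI = begin
      (theta I ⊛ powS I m) n         ≡⟨ ⊛-congʳ (powS I m) θI≗Tz⊛I³ n ⟩
      ((Tz ⊛ powS I 3) ⊛ powS I m) n ≡⟨ ⊛-assoc Tz (powS I 3) (powS I m) n ⟩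
      (Tz ⊛ (powS I 3 ⊛ powS I m)) n ≡⟨ ⊛-congˡ Tz (powS-+ I 3 m) n ⟨
      (Tz ⊛ powS I (3 + m)) n        ≡⟨ cong (λ j → (Tz ⊛ powS I (suc j)) n) (ℕP.+-comm 2 m) ⟩
      Z n                            ∎

    from-θIᵐ : (I ⊛ theta (powS I m)) n ≡ ℚn m ℚ.* Z n
    from-θIᵐ = begin
      (I ⊛ theta (powS I m)) n                   ≡⟨ ⊛-congˡ I (θ-powS-I m) n ⟩
      (I ⊛ scale (ℚn m) (Tz ⊛ powS I (m + 2))) n ≡⟨ ⊛-scale (ℚn m) I (Tz ⊛ powS I (m + 2)) n ⟩
      ℚn m ℚ.* (I ⊛ (Tz ⊛ powS I (m + 2))) n     ≡⟨ cong (ℚn m ℚ.*_) (⊛-left-comm I Tz (powS I (m + 2)) n) ⟩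
      ℚn m ℚ.* Z n                               ∎

open TreeFunction

module Estimates where

  0≤ℚn : ∀ n → 0ℚ ℚ.≤ ℚn n
  0≤ℚn n = ℚP.nonNegative⁻¹ (ℚn n) {{ℚP.normalize-nonNeg n 1}}

  0⪯What : ∀ g t → zeroS ⪯ What g t
  0⪯What g t n = ℚP.nonNegative⁻¹ (What g t n) {{ℚP.normalize-nonNeg (g n t) (n !) {{ℕP._!≢0 n}}}}

  0≤q-p⇒p≤q : ∀ {p q} → 0ℚ ℚ.≤ q ℚ.- p → p ℚ.≤ q
  0≤q-p⇒p≤q {p} {q} 0≤q-p = begin
    p               ≡⟨ ℚP.+-identityʳ p ⟨
    p ℚ.+ 0ℚ        ≤⟨ ℚP.+-monoʳ-≤ p 0≤q-p ⟩
    p ℚ.+ (q ℚ.- p) ≡⟨ p+[q-p]≡q p q ⟩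
    q               ∎
    where
    open ℚP.≤-Reasoning
    open +-*-Solver
    p+[q-p]≡q : ∀ p q → p ℚ.+ (q ℚ.- p) ≡ q
    p+[q-p]≡q = solve 2 (λ p q → p :+ (q :- p) := q) refl

  0⪯B-A⇒A⪯B : ∀ A B → zeroS ⪯ (B -S A) → A ⪯ B
  0⪯B-A⇒A⪯B A B 0⪯B-A n = 0≤q-p⇒p≤q (0⪯B-A n)

  *-mono-≤-nonNeg : ∀ {a a′ b b′} → 0ℚ ℚ.≤ a → a ℚ.≤ a′ → 0ℚ ℚ.≤ b → b ℚ.≤ b′ →
                    a ℚ.* b ℚ.≤ a′ ℚ.* b′
  *-mono-≤-nonNeg {a} {a′} {b} {b′} 0≤a a≤a′ 0≤b b≤b′ = ℚP.≤-trans
    (ℚP.*-monoʳ-≤-nonNeg b {{ℚ.nonNegative 0≤b}} a≤a′)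
    (ℚP.*-monoˡ-≤-nonNeg a′ {{ℚ.nonNegative (ℚP.≤-trans 0≤a a≤a′)}} b≤b′)

  ∑-mono-≤ : ∀ f h n → (∀ i → i ≤ n → f i ℚ.≤ h i) → sumUpTo f n ℚ.≤ sumUpTo h n
  ∑-mono-≤ f h zero    f≤h = f≤h 0 z≤n
  ∑-mono-≤ f h (suc n) f≤h =
    ℚP.+-mono-≤ (∑-mono-≤ f h n (λ i i≤n → f≤h i (ℕP.m≤n⇒m≤1+n i≤n))) (f≤h (suc n) ℕP.≤-refl)

  ⊛-mono-⪯ : ∀ {A A′ B B′} → zeroS ⪯ A → A ⪯ A′ → zeroS ⪯ B → B ⪯ B′ → (A ⊛ B) ⪯ (A′ ⊛ B′)
  ⊛-mono-⪯ {A} {A′} {B} {B′} 0⪯A A⪯A′ 0⪯B B⪯B′ n =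
    ∑-mono-≤ _ _ n (λ i _ → *-mono-≤-nonNeg (0⪯A i) (A⪯A′ i) (0⪯B (n ∸ i)) (B⪯B′ (n ∸ i)))

  θ-mono-⪯ : ∀ {A B} → A ⪯ B → theta A ⪯ theta B
  θ-mono-⪯ A⪯B n = ℚP.*-monoˡ-≤-nonNeg (ℚn n) {{ℚ.nonNegative (0≤ℚn n)}} (A⪯B n)

  θ-nonNeg : ∀ {A} → zeroS ⪯ A → zeroS ⪯ theta A
  θ-nonNeg {A} 0⪯A n = ℚP.≤-trans (ℚP.≤-reflexive (sym (ℚP.*-zeroʳ (ℚn n)))) (θ-mono-⪯ 0⪯A n)

  θ-scale : ∀ c A → theta (scale c A) ≗ scale c (theta A)
  θ-scale c A n = ℚ*.x∙yz≈y∙xz (ℚn n) c (A n)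

  θ-bound : ∀ {W} β m → zeroS ⪯ (scale β (powS I m) -S W) →
            theta W ⪯ scale (β ℚ.* ℚn m) (Tz ⊛ powS I (m + 2))
  θ-bound {W} β m hyp n = begin
    theta W n                                ≤⟨ θ-mono-⪯ (0⪯B-A⇒A⪯B W (scale β (powS I m)) hyp) n ⟩
    theta (scale β (powS I m)) n             ≡⟨ θ-scale β (powS I m) n ⟩
    β ℚ.* theta (powS I m) n                 ≡⟨ cong (β ℚ.*_) (θ-powS-I m n) ⟩
    β ℚ.* (ℚn m ℚ.* (Tz ⊛ powS I (m + 2)) n) ≡⟨ ℚP.*-assoc β (ℚn m) _ ⟨
    β ℚ.* ℚn m ℚ.* (Tz ⊛ powS I (m + 2)) n   ∎
    where open ℚP.≤-Reasoning

  Tz⊛Iᵃ⊛Tz⊛Iᶜ : ∀ a c → (Tz ⊛ powS I a) ⊛ (Tz ⊛ powS I c) ≗ powS Tz 2 ⊛ powS I (a + c)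
  Tz⊛Iᵃ⊛Tz⊛Iᶜ a c n = begin
    ((Tz ⊛ powS I a) ⊛ (Tz ⊛ powS I c)) n ≡⟨ ⊛-assoc Tz (powS I a) (Tz ⊛ powS I c) n ⟩
    (Tz ⊛ (powS I a ⊛ (Tz ⊛ powS I c))) n ≡⟨ ⊛-congˡ Tz (⊛-left-comm (powS I a) Tz (powS I c)) n ⟩
    (Tz ⊛ (Tz ⊛ (powS I a ⊛ powS I c))) n ≡⟨ ⊛-congˡ Tz (⊛-congˡ Tz (powS-+ I a c)) n ⟨
    (Tz ⊛ (Tz ⊛ powS I (a + c))) n        ≡⟨ ⊛-assoc Tz Tz (powS I (a + c)) n ⟨
    ((Tz ⊛ Tz) ⊛ powS I (a + c)) n        ≡⟨ ⊛-congʳ (powS I (a + c)) (⊛-congˡ Tz (⊛-identityʳ Tz)) n ⟨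
    (powS Tz 2 ⊛ powS I (a + c)) n        ∎
    where open ≡-Reasoning

  θ-product-bound : ∀ {U V} β γ u v → zeroS ⪯ U → zeroS ⪯ V →
    zeroS ⪯ (scale β (powS I u) -S U) → zeroS ⪯ (scale γ (powS I v) -S V) →
    (theta U ⊛ theta V) ⪯ scale (β ℚ.* ℚn u ℚ.* (γ ℚ.* ℚn v)) (powS Tz 2 ⊛ powS I (u + 2 + (v + 2)))
  θ-product-bound {U} {V} β γ u v 0⪯U 0⪯V U-bound V-bound n = begin
    (theta U ⊛ theta V) n
      ≤⟨ ⊛-mono-⪯ (θ-nonNeg 0⪯U) (θ-bound β u U-bound) (θ-nonNeg 0⪯V) (θ-bound γ v V-bound) n ⟩
    (scale β′ (Tz ⊛ powS I (u + 2)) ⊛ scale γ′ (Tz ⊛ powS I (v + 2))) n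
      ≡⟨ scale-⊛ β′ (Tz ⊛ powS I (u + 2)) (scale γ′ (Tz ⊛ powS I (v + 2))) n ⟩
    β′ ℚ.* ((Tz ⊛ powS I (u + 2)) ⊛ scale γ′ (Tz ⊛ powS I (v + 2))) n
      ≡⟨ cong (β′ ℚ.*_) (⊛-scale γ′ (Tz ⊛ powS I (u + 2)) (Tz ⊛ powS I (v + 2)) n) ⟩
    β′ ℚ.* (γ′ ℚ.* ((Tz ⊛ powS I (u + 2)) ⊛ (Tz ⊛ powS I (v + 2))) n)
      ≡⟨ ℚP.*-assoc β′ γ′ _ ⟨
    β′ ℚ.* γ′ ℚ.* ((Tz ⊛ powS I (u + 2)) ⊛ (Tz ⊛ powS I (v + 2))) n
      ≡⟨ cong (β′ ℚ.* γ′ ℚ.*_) (Tz⊛Iᵃ⊛Tz⊛Iᶜ (u + 2) (v + 2) n) ⟩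
    β′ ℚ.* γ′ ℚ.* (powS Tz 2 ⊛ powS I (u + 2 + (v + 2))) n
      ∎
    where
    open ℚP.≤-Reasoning
    β′ γ′ : ℚ
    β′ = β ℚ.* ℚn u
    γ′ = γ ℚ.* ℚn v

  θ-product-bound-3t : ∀ {U V} β γ t s K → t + s ≡ K → zeroS ⪯ U → zeroS ⪯ V →
    zeroS ⪯ (scale β (powS I (3 * t)) -S U) → zeroS ⪯ (scale γ (powS I (3 * s)) -S V) →
    (theta U ⊛ theta V) ⪯ scale (ℚn 9 ℚ.* (ℚn t ℚ.* ℚn s ℚ.* β ℚ.* γ)) (powS Tz 2 ⊛ powS I (3 * K + 4))
  θ-product-bound-3t {U} {V} β γ t s K t+s≡K 0⪯U 0⪯V U-bound V-bound n = begin
    (theta U ⊛ theta V) n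
      ≤⟨ θ-product-bound β γ (3 * t) (3 * s) 0⪯U 0⪯V U-bound V-bound n ⟩
    β ℚ.* ℚn (3 * t) ℚ.* (γ ℚ.* ℚn (3 * s)) ℚ.* (powS Tz 2 ⊛ powS I (3 * t + 2 + (3 * s + 2))) n
      ≡⟨ cong₂ (λ c m → c ℚ.* (powS Tz 2 ⊛ powS I m) n) coefficient exponent ⟩
    ℚn 9 ℚ.* (ℚn t ℚ.* ℚn s ℚ.* β ℚ.* γ) ℚ.* (powS Tz 2 ⊛ powS I (3 * K + 4)) n
      ∎
    where
    open ℚP.≤-Reasoning

    exponent : 3 * t + 2 + (3 * s + 2) ≡ 3 * K + 4
    exponent = trans (collect t s) (cong (λ m → 3 * m + 4) t+s≡K)
      where
      collect : ∀ t s → 3 * t + 2 + (3 * s + 2) ≡ 3 * (t + s) + 4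
      collect = solve-∀

    coefficient : β ℚ.* ℚn (3 * t) ℚ.* (γ ℚ.* ℚn (3 * s)) ≡ ℚn 9 ℚ.* (ℚn t ℚ.* ℚn s ℚ.* β ℚ.* γ)
    coefficient = begin-equality
      β ℚ.* ℚn (3 * t) ℚ.* (γ ℚ.* ℚn (3 * s))
        ≡⟨ cong₂ (λ x y → β ℚ.* x ℚ.* (γ ℚ.* y)) (ℚn-* 3 t) (ℚn-* 3 s) ⟩
      β ℚ.* (ℚn 3 ℚ.* ℚn t) ℚ.* (γ ℚ.* (ℚn 3 ℚ.* ℚn s))
        ≡⟨ regroup β γ (ℚn t) (ℚn s) (ℚn 3) ⟩
      ℚn 3 ℚ.* ℚn 3 ℚ.* (ℚn t ℚ.* ℚn s ℚ.* β ℚ.* γ)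
        ≡⟨ cong (ℚ._* (ℚn t ℚ.* ℚn s ℚ.* β ℚ.* γ)) (ℚn-* 3 3) ⟨
      ℚn 9 ℚ.* (ℚn t ℚ.* ℚn s ℚ.* β ℚ.* γ)
        ∎
      where
      open +-*-Solver
      regroup : ∀ x y p q r → x ℚ.* (r ℚ.* p) ℚ.* (y ℚ.* (r ℚ.* q)) ≡ r ℚ.* r ℚ.* (p ℚ.* q ℚ.* x ℚ.* y)
      regroup = solve 5 (λ x y p q r → x :* (r :* p) :* (y :* (r :* q)) := r :* r :* (p :* q :* x :* y)) refl

  sumFromTo-mono-≤ : ∀ K f h → (∀ t → 1 ≤ t → t ≤ K → f t ℚ.≤ h t) → sumFromTo 1 K f ℚ.≤ sumFromTo 1 K h
  sumFromTo-mono-≤ zero    f h _   = ℚP.≤-refl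
  sumFromTo-mono-≤ (suc K) f h f≤h =
    ℚP.+-mono-≤ (sumFromTo-mono-≤ K f h (λ t 1≤t t≤K → f≤h t 1≤t (ℕP.m≤n⇒m≤1+n t≤K)))
                (f≤h (suc K) (s≤s z≤n) ℕP.≤-refl)

  sumFromTo-distrib : ∀ K f a x → sumFromTo 1 K (λ t → a ℚ.* f t ℚ.* x) ≡ a ℚ.* sumFromTo 1 K f ℚ.* x
  sumFromTo-distrib zero    f a x = sym (trans (cong (ℚ._* x) (ℚP.*-zeroʳ a)) (ℚP.*-zeroˡ x))
  sumFromTo-distrib (suc K) f a x =
    trans (cong (ℚ._+ a ℚ.* f (suc K) ℚ.* x) (sumFromTo-distrib K f a x)) (collect a (sumFromTo 1 K f) (f (suc K)) x)
    where
    open +-*-Solver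
    collect : ∀ a s y x → a ℚ.* s ℚ.* x ℚ.+ a ℚ.* y ℚ.* x ≡ a ℚ.* (s ℚ.+ y) ℚ.* x
    collect = solve 4 (λ a s y x → a :* s :* x :+ a :* y :* x := a :* (s :+ y) :* x) refl

open Estimates

lemma24 : (ξ : List AnyGraph) →
    All (λ H → Connected (proj₂ H) × HasCycle (proj₂ H)) ξ →
    (g : ℕ → ℕ → ℕ) → IsCountOf ξ g →
    (b : ℕ → ℚ) → IsWright b →
    (k : ℕ) → 1 ≤ k →
    (∀ t → 1 ≤ t → t ≤ k ∸ 1 →
    zeroS ⪯ (scale (b t) (invOneMinusTPow (3 * t)) -S What g t)) →
    Lambda g k ⪯ scale (ℚn 9 ℚ.* calB b k)
    (powS Tz 2 ⊛ invOneMinusTPow (3 * k + 4))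
lemma24 _ _ g _ b _ (suc k) _ What-bound n = begin
  Lambda g (suc k) n                            ≤⟨ sumFromTo-mono-≤ k _ _ term-bound ⟩
  sumFromTo 1 k (λ t → ℚn 9 ℚ.* term t ℚ.* X n) ≡⟨ sumFromTo-distrib k term (ℚn 9) (X n) ⟩
  ℚn 9 ℚ.* calB b (suc k) ℚ.* X n               ∎
  where
  open ℚP.≤-Reasoning

  X : Series
  X = powS Tz 2 ⊛ powS I (3 * suc k + 4)

  term : ℕ → ℚ
  term t = ℚn t ℚ.* ℚn (suc k ∸ t) ℚ.* b t ℚ.* b (suc k ∸ t)

  term-bound : ∀ t → 1 ≤ t → t ≤ k →
               (theta (What g t) ⊛ theta (What g (suc k ∸ t))) n ℚ.≤ ℚn 9 ℚ.* term t ℚ.* X n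
  term-bound t 1≤t t≤k =
    θ-product-bound-3t (b t) (b (suc k ∸ t)) t (suc k ∸ t) (suc k) (ℕP.m+[n∸m]≡n (ℕP.m≤n⇒m≤1+n t≤k))
      (0⪯What g t) (0⪯What g (suc k ∸ t))
      (What-bound t 1≤t t≤k) (What-bound (suc k ∸ t) (ℕP.m<n⇒0<n∸m (s≤s t≤k)) (ℕP.∸-monoʳ-≤ (suc k) 1≤t)) n
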